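{- Let $q$ be an odd prime power with $q\ge 5$ and let $n\ge 2$ be an integer. Let $\mathcal{F}_{q,n}$ be the class of maps $F:\mathbb{F}_q\to\mathbb{F}_q$ defined in the context. Then the spectrum of $\mathcal{F}_{q,n}$ satisfies $$v(\mathcal{F}_{q,n})\subseteq \{2,3,\ldots,n+1,\ q-n,q-n+1,\ldots,q-2,\ q\}.$$
   Context: Construction of $\mathcal{F}_{q,n}$: for $a,b\in\mathbb{F}_q^*$ put $g(x)=ax+b$, and let $\mathbf{O}_n=\{x_1,\ldots,x_n\}$ be a set of $n$ distinct elements of $\mathbb{F}_q$ with $x_1=0$ and $x_n=-b/a$. Define the permutation $f$ of $\mathbb{F}_q$ by $f(x)=g(x)$ for $x\notin\mathbf{O}_n$, $f(x_i)=g(x_{i-1})$ for $2\le i\le n$, and $f(x_1)=g(x_n)=0$. Put $F(x)=f(x)+x$; equivalently $F(\delta)=(a+1)\delta+b$ for $\delta\notin\mathbf{O}_n$, $F(x_i)=ax_{i-1}+x_i+b$ for $2\le i\le n$, and $F(0)=0$. The class $\mathcal{F}_{q,n}$ consists of all such $F$ (identified with their reduced polynomials of degree $\le q-1$), as $a,b\in\mathbb{F}_q^*$ and $\mathbf{O}_n$ vary. The value set of $F$ is $V_F=\{F(c):c\in\mathbb{F}_q\}$, and the spectrum of a class $\mathcal{C}$ is $v(\mathcal{C})=\{|V_F|:F\in\mathcal{C}\}$. -}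

module Defs where

open import Level using (0ℓ)
open import Data.Nat using (ℕ; zero; suc)
open import Data.Fin using (Fin; zero; suc; inject₁)
open import Data.Fin.Properties using (any?)
open import Data.List using (List; length; map; deduplicate)
open import Data.List.Membership.Propositional using (_∈_)
open import Data.List.Relation.Unary.Unique.Propositional using (Unique)
open import Data.Product using (_,_; Σ)
open import Relation.Nullary using (¬_; Dec; yes; no)
open import Relation.Binary.PropositionalEquality using (_≡_)
open import Algebra.Structures using (IsCommutativeRing)

record FiniteField : Set₁ where
  infixl 7 _*_
  infixl 6 _+_
  field
    Carrier : Set
    _+_ _*_ : Carrier → Carrier → Carrier
    -_ : Carrier → Carrier
    0# 1# : Carrier
    isCommutativeRing : IsCommutativeRing _≡_ _+_ _*_ -_ 0# 1#
    0≢1 : ¬ (0# ≡ 1#)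
    inv : (x : Carrier) → ¬ (x ≡ 0#) → Carrier
    inv-correct : (x : Carrier) (x≢0 : ¬ (x ≡ 0#)) → x * inv x x≢0 ≡ 1#
    _≟_ : (x y : Carrier) → Dec (x ≡ y)
    elements : List Carrier
    elements-complete : (x : Carrier) → x ∈ elements
    elements-unique : Unique elements

  order : ℕ
  order = length elements

module _ (K : FiniteField) where
  open FiniteField K

  gMap : Carrier → Carrier → Carrier → Carrier
  gMap a b x = a * x + b

  -- The permutation f built from g and O_n = {O 0, ..., O (n-1)}
  -- (paper's x_i is O (i-1)):
  --   f(x) = g(x) for x ∉ O_n, f(x_1) = 0, f(x_i) = g(x_{i-1}) for 2 ≤ i ≤ n.
  fMap : (a b : Carrier) {n : ℕ} (O : Fin n → Carrier) → Carrier → Carrier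
  fMap a b {n} O x with any? (λ i → O i ≟ x)
  ... | yes (zero , _)  = 0#
  ... | yes (suc j , _) = gMap a b (O (inject₁ j))
  ... | no _            = gMap a b x

  FMap : (a b : Carrier) {n : ℕ} (O : Fin n → Carrier) → Carrier → Carrier
  FMap a b O x = fMap a b O x + x

  valueSetSize : (Carrier → Carrier) → ℕ
  valueSetSize F = length (deduplicate _≟_ (map F elements))

module Submission where

-- Off O_n the map F is the affine map x ↦ (a + 1) x + b. If a = -1 it is constant (= b) there,
-- so F takes at most n + 1 values, and at least the two values 0 = F(0) and b unless O_n is the
-- whole field. If a ≠ -1 it is injective there, so F takes at least q - n values. The value
-- q - 1 is excluded because f is a permutation: ∑ F(x) = ∑ f(x) + ∑ x = ∑ x, since the elements
-- of a field with more than two elements sum to 0. If F missed exactly one value w, it would take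
-- exactly one value d twice, and then ∑ F(x) = ∑ x - w + d with d ≠ w.

open import Defs
open import Level using (0ℓ)
open import Data.Nat as ℕ using (ℕ; suc; _≤_; _<_; _∸_; z≤n)
import Data.Nat.Properties as ℕ
open import Data.Nat.Divisibility using (_∣_)
open import Data.Fin using (Fin; zero; suc; fromℕ; inject₁; lower₁; toℕ)
open import Data.Fin.Properties using (any?; toℕ-injective; toℕ-fromℕ; inject₁-lower₁)
open import Data.List using (List; []; _∷_; _++_; map; foldr; filter; tabulate; length; deduplicate)
open import Data.List.Properties using (length-map; length-++; length-tabulate)
open import Data.List.Membership.Propositional using (_∈_; _∉_; find)
import Data.List.Membership.DecPropositional as DecMembership
open import Data.List.Membership.Propositional.Properties
  using (∈-∃++; ∈-map⁺; ∈-map⁻; ∈-deduplicate⁺; ∈-deduplicate⁻; ∈-tabulate⁺;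
         ∈-filter⁺; ∈-filter⁻; ∈-++⁺ˡ; ∈-++⁺ʳ)
open import Data.List.Relation.Unary.Any using (here; there)
import Data.List.Relation.Unary.Any as Any
import Data.List.Relation.Unary.All as All
open import Data.List.Relation.Unary.All using ([]; _∷_)
open import Data.List.Relation.Unary.AllPairs using ([]; _∷_)
open import Data.List.Relation.Unary.Unique.Propositional using (Unique)
import Data.List.Relation.Unary.Unique.Propositional.Properties as UP
open import Data.List.Relation.Unary.Unique.DecPropositional.Properties using (deduplicate-!)
open import Data.List.Relation.Binary.Subset.Propositional using (_⊆_)
open import Data.List.Relation.Binary.Permutation.Propositional
  using (_↭_; ↭-sym; ↭-trans; ↭-prep; ↭⇒↭ₛ)
open import Data.List.Relation.Binary.Permutation.Propositional.Properties
  using (∈-resp-↭; shift; ↭-length; ++-comm)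
open import Data.List.Relation.Binary.Permutation.Setoid.Properties using (foldr-commMonoid)
open import Data.Product using (∃; _×_; _,_; proj₂)
open import Data.Sum as Sum using (_⊎_; inj₁; inj₂)
open import Function using (_∘_)
open import Function.Definitions using (Injective)
open import Relation.Binary.Definitions using (DecidableEquality)
open import Relation.Nullary using (¬_; Dec; yes; no; ¬?; contradiction)
open import Relation.Nullary.Decidable using (decidable-stable)
open import Relation.Binary.PropositionalEquality
  using (_≡_; _≢_; ≢-sym; refl; sym; trans; cong; cong₂; subst; setoid; module ≡-Reasoning)
open import Algebra.Bundles using (CommutativeRing)
open import Algebra.Structures using (IsCommutativeRing)

module _ {ℓ} {A : Set ℓ} where

  ∈-drop-mid : ∀ {x z : A} us vs → z ∈ us ++ x ∷ vs → z ≢ x → z ∈ us ++ vs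
  ∈-drop-mid {x} us vs z∈ z≢x with ∈-resp-↭ (shift x us vs) z∈
  ... | here z≡x = contradiction z≡x z≢x
  ... | there z∈us++vs = z∈us++vs

  unique∧⊆⇒↭++ : {xs ys : List A} → Unique xs → xs ⊆ ys → ∃ λ zs → ys ↭ zs ++ xs
  unique∧⊆⇒↭++ {[]} {ys} _ _ = ys , ↭-sym (++-comm ys [])
  unique∧⊆⇒↭++ {x ∷ xs} (x∉xs ∷ uxs) x∷xs⊆ys
    with us , vs , refl ← ∈-∃++ (x∷xs⊆ys (here refl))
    with zs , p ← unique∧⊆⇒↭++ uxs (λ z∈xs →
                    ∈-drop-mid us vs (x∷xs⊆ys (there z∈xs)) (≢-sym (All.lookup x∉xs z∈xs)))
    = zs , ↭-trans (shift x us vs) (↭-trans (↭-prep x p) (↭-sym (shift x zs xs)))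

  private
    ↭++⇒length : {ys : List A} (zs xs : List A) → ys ↭ zs ++ xs → length ys ≡ length zs ℕ.+ length xs
    ↭++⇒length zs _ p = trans (↭-length p) (length-++ zs)

  unique∧⊆⇒length≤ : {xs ys : List A} → Unique xs → xs ⊆ ys → length xs ≤ length ys
  unique∧⊆⇒length≤ uxs xs⊆ys with zs , p ← unique∧⊆⇒↭++ uxs xs⊆ys =
    ℕ.≤-trans (ℕ.m≤n+m _ (length zs)) (ℕ.≤-reflexive (sym (↭++⇒length zs _ p)))

  unique∧⊆∧length≡⇒↭ : {xs ys : List A} → Unique xs → xs ⊆ ys →
                        length ys ≡ length xs → ys ↭ xs
  unique∧⊆∧length≡⇒↭ {xs} uxs xs⊆ys eq with unique∧⊆⇒↭++ uxs xs⊆ys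
  ... | [] , p = p
  ... | zs@(_ ∷ _) , p = contradiction (trans (sym eq) (↭++⇒length zs xs p)) (ℕ.m≢1+n+m _)

  unique∧⊆∧length≡suc⇒↭∷ : {xs ys : List A} → Unique xs → xs ⊆ ys →
                            length ys ≡ suc (length xs) → ∃ λ d → ys ↭ d ∷ xs
  unique∧⊆∧length≡suc⇒↭∷ {xs} uxs xs⊆ys eq with unique∧⊆⇒↭++ uxs xs⊆ys
  ... | [] , p = contradiction (trans (sym (↭++⇒length [] xs p)) eq) (ℕ.1+n≢n ∘ sym)
  ... | d ∷ [] , p = d , p
  ... | zs@(_ ∷ _ ∷ _) , p =
    contradiction (trans (sym eq) (↭++⇒length zs xs p)) (ℕ.m≢1+n+m _ ∘ ℕ.suc-injective)

  module _ (_≟_ : DecidableEquality A) where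
    open DecMembership _≟_ using (_∈?_)

    length<⇒∃∉ : {xs ys : List A} → Unique ys → length xs < length ys → ∃ λ y → y ∈ ys × y ∉ xs
    length<⇒∃∉ {xs} {ys} uys xs<ys with Any.any? (λ y → ¬? (y ∈? xs)) ys
    ... | yes y∉xs = find y∉xs
    ... | no ∄y∉xs = contradiction (unique∧⊆⇒length≤ uys ys⊆xs) (ℕ.<⇒≱ xs<ys)
      where
      ys⊆xs : ys ⊆ xs
      ys⊆xs {y} y∈ys =
        decidable-stable (y ∈? xs) (λ y∉xs → ∄y∉xs (Any.map (λ { refl → y∉xs }) y∈ys))

module _ (K : FiniteField) where
  open FiniteField K
  open IsCommutativeRing isCommutativeRing
    using (+-isCommutativeMonoid; +-identityˡ; *-comm; *-assoc; *-identityˡ; *-identityʳ;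
           distribˡ; zeroʳ)

  private
    commutativeRing : CommutativeRing 0ℓ 0ℓ
    commutativeRing = record { isCommutativeRing = isCommutativeRing }
  open CommutativeRing commutativeRing using (+-group; +-commutativeSemigroup)
  open import Algebra.Properties.Group +-group using () renaming (∙-cancelʳ to +-cancelʳ)
  open import Algebra.Properties.CommutativeSemigroup +-commutativeSemigroup
    using () renaming (interchange to +-interchange)

  ∑ : List Carrier → Carrier
  ∑ = foldr _+_ 0#

  ∑-↭ : {xs ys : List Carrier} → xs ↭ ys → ∑ xs ≡ ∑ ys
  ∑-↭ p = foldr-commMonoid (setoid Carrier) +-isCommutativeMonoid (↭⇒↭ₛ p)

  ∑-map-+id : (φ : Carrier → Carrier) (xs : List Carrier) →
              ∑ (map (λ x → φ x + x) xs) ≡ ∑ (map φ xs) + ∑ xs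
  ∑-map-+id φ [] = sym (+-identityˡ 0#)
  ∑-map-+id φ (x ∷ xs) = trans (cong ((φ x + x) +_) (∑-map-+id φ xs))
                               (+-interchange (φ x) x (∑ (map φ xs)) (∑ xs))

  ∑-map-*ˡ : (c : Carrier) (xs : List Carrier) → ∑ (map (c *_) xs) ≡ c * ∑ xs
  ∑-map-*ˡ c [] = sym (zeroʳ c)
  ∑-map-*ˡ c (x ∷ xs) = trans (cong (c * x +_) (∑-map-*ˡ c xs)) (sym (distribˡ c x (∑ xs)))

  x*[x⁻¹*y]≡y : ∀ x (x≢0 : x ≢ 0#) y → x * (inv x x≢0 * y) ≡ y
  x*[x⁻¹*y]≡y x x≢0 y = begin
    x * (inv x x≢0 * y) ≡⟨ *-assoc x _ y ⟨
    (x * inv x x≢0) * y ≡⟨ cong (_* y) (inv-correct x x≢0) ⟩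
    1# * y              ≡⟨ *-identityˡ y ⟩
    y                   ∎
    where open ≡-Reasoning

  x⁻¹*[x*y]≡y : ∀ x (x≢0 : x ≢ 0#) y → inv x x≢0 * (x * y) ≡ y
  x⁻¹*[x*y]≡y x x≢0 y = begin
    inv x x≢0 * (x * y) ≡⟨ *-assoc _ x y ⟨
    (inv x x≢0 * x) * y ≡⟨ cong (_* y) (trans (*-comm _ x) (inv-correct x x≢0)) ⟩
    1# * y              ≡⟨ *-identityˡ y ⟩
    y                   ∎
    where open ≡-Reasoning

  *-cancelˡ-nonZero : ∀ z {x y} → z ≢ 0# → z * x ≡ z * y → x ≡ y
  *-cancelˡ-nonZero z {x} {y} z≢0 zx≡zy = begin
    x                   ≡⟨ x⁻¹*[x*y]≡y z z≢0 x ⟨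
    inv z z≢0 * (z * x) ≡⟨ cong (inv z z≢0 *_) zx≡zy ⟩
    inv z z≢0 * (z * y) ≡⟨ x⁻¹*[x*y]≡y z z≢0 y ⟩
    y                   ∎
    where open ≡-Reasoning

  Surjective : (Carrier → Carrier) → Set
  Surjective φ = ∀ y → ∃ λ x → φ x ≡ y

  map-surjective↭elements : {φ : Carrier → Carrier} → Surjective φ → map φ elements ↭ elements
  map-surjective↭elements {φ} surj =
    unique∧⊆∧length≡⇒↭ elements-unique elements⊆image (length-map φ elements)
    where
    elements⊆image : elements ⊆ map φ elements
    elements⊆image {y} _ with x , refl ← surj y = ∈-map⁺ φ (elements-complete x)

  ∑-map-surjective : {φ : Carrier → Carrier} → Surjective φ → ∑ (map φ elements) ≡ ∑ elements
  ∑-map-surjective surj = ∑-↭ (map-surjective↭elements surj)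

  ∃≢0∧≢1 : 3 ≤ order → ∃ λ c → c ≢ 0# × c ≢ 1#
  ∃≢0∧≢1 3≤q with length<⇒∃∉ _≟_ {xs = 0# ∷ 1# ∷ []} elements-unique 3≤q
  ... | c , _ , c∉01 = c , (λ c≡0 → c∉01 (here c≡0)) , (λ c≡1 → c∉01 (there (here c≡1)))

  ∑-elements≡0 : 3 ≤ order → ∑ elements ≡ 0#
  ∑-elements≡0 3≤q with ∑ elements ≟ 0#
  ... | yes S≡0 = S≡0
  ... | no S≢0 with c , c≢0 , c≢1 ← ∃≢0∧≢1 3≤q =
    contradiction (*-cancelˡ-nonZero (∑ elements) S≢0 Sc≡S1) c≢1
    where
    Sc≡S1 : ∑ elements * c ≡ ∑ elements * 1#
    Sc≡S1 = begin
      ∑ elements * c             ≡⟨ *-comm (∑ elements) c ⟩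
      c * ∑ elements             ≡⟨ ∑-map-*ˡ c elements ⟨
      ∑ (map (c *_) elements)    ≡⟨ ∑-map-surjective (λ y → inv c c≢0 * y , x*[x⁻¹*y]≡y c c≢0 y) ⟩
      ∑ elements                 ≡⟨ *-identityʳ (∑ elements) ⟨
      ∑ elements * 1#            ∎
      where open ≡-Reasoning

  ∑-map-+id-surjective : 3 ≤ order → {f : Carrier → Carrier} → Surjective f →
                         ∑ (map (λ x → f x + x) elements) ≡ ∑ elements
  ∑-map-+id-surjective 3≤q {f} surj = begin
    ∑ (map (λ x → f x + x) elements) ≡⟨ ∑-map-+id f elements ⟩
    ∑ (map f elements) + ∑ elements  ≡⟨ cong (_+ ∑ elements) (∑-map-surjective surj) ⟩
    ∑ elements + ∑ elements          ≡⟨ cong (_+ ∑ elements) (∑-elements≡0 3≤q) ⟩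
    0# + ∑ elements                  ≡⟨ +-identityˡ (∑ elements) ⟩
    ∑ elements                       ∎
    where open ≡-Reasoning

  valueList : (Carrier → Carrier) → List Carrier
  valueList F = deduplicate _≟_ (map F elements)

  valueList-unique : (F : Carrier → Carrier) → Unique (valueList F)
  valueList-unique F = deduplicate-! _≟_ (map F elements)

  ∈-valueList⁺ : (F : Carrier → Carrier) (x : Carrier) → F x ∈ valueList F
  ∈-valueList⁺ F x = ∈-deduplicate⁺ _≟_ (∈-map⁺ F (elements-complete x))

  ∈-valueList⁻ : (F : Carrier → Carrier) {y : Carrier} → y ∈ valueList F → ∃ λ x → y ≡ F x
  ∈-valueList⁻ F y∈V with x , _ , y≡Fx ← ∈-map⁻ F (∈-deduplicate⁻ _≟_ (map F elements) y∈V) =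
    x , y≡Fx

  valueSetSize≤order : (F : Carrier → Carrier) → valueSetSize K F ≤ order
  valueSetSize≤order F = unique∧⊆⇒length≤ (valueList-unique F) (λ {y} _ → elements-complete y)

  module _ (F : Carrier → Carrier) (1+m≡q : suc (valueSetSize K F) ≡ order) where

    image-↭-repeated∷valueList : ∃ λ d → d ∈ valueList F × map F elements ↭ d ∷ valueList F
    image-↭-repeated∷valueList
      with d , image↭ ← unique∧⊆∧length≡suc⇒↭∷ (valueList-unique F)
                          (∈-deduplicate⁻ _≟_ (map F elements))
                          (trans (length-map F elements) (sym 1+m≡q))
      = d , ∈-deduplicate⁺ _≟_ (∈-resp-↭ (↭-sym image↭) (here refl)) , image↭

    elements-↭-missing∷valueList : ∃ λ w → w ∉ valueList F × elements ↭ w ∷ valueList F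
    elements-↭-missing∷valueList
      with w , _ , w∉V ← length<⇒∃∉ _≟_ elements-unique (ℕ.≤-reflexive 1+m≡q)
      = w , w∉V ,
        unique∧⊆∧length≡⇒↭ (w∉V′ ∷ valueList-unique F) (λ {y} _ → elements-complete y) (sym 1+m≡q)
      where
      w∉V′ : All.All (w ≢_) (valueList F)
      w∉V′ = All.tabulate λ y∈V w≡y → w∉V (subst (_∈ valueList F) (sym w≡y) y∈V)

    ∑-image≢∑-elements : ∑ (map F elements) ≢ ∑ elements
    ∑-image≢∑-elements ∑image≡∑elements
      with d , d∈V , image↭ ← image-↭-repeated∷valueList
      with w , w∉V , elements↭ ← elements-↭-missing∷valueList
      = w∉V (subst (_∈ valueList F) (+-cancelʳ (∑ (valueList F)) d w d+S≡w+S) d∈V)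
      where
      d+S≡w+S : d + ∑ (valueList F) ≡ w + ∑ (valueList F)
      d+S≡w+S = begin
        d + ∑ (valueList F)  ≡⟨ ∑-↭ image↭ ⟨
        ∑ (map F elements)   ≡⟨ ∑image≡∑elements ⟩
        ∑ elements           ≡⟨ ∑-↭ elements↭ ⟩
        w + ∑ (valueList F)  ∎
        where open ≡-Reasoning

  valueSetSize-+id≢pred : 3 ≤ order → {f : Carrier → Carrier} → Surjective f →
                          suc (valueSetSize K (λ x → f x + x)) ≢ order
  valueSetSize-+id≢pred 3≤q surj 1+m≡q =
    ∑-image≢∑-elements _ 1+m≡q (∑-map-+id-surjective 3≤q surj)

  module _ {n : ℕ} (O : Fin n → Carrier) where

    Outside : Carrier → Set
    Outside x = ¬ (∃ λ i → O i ≡ x)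

    outside? : (x : Carrier) → Dec (Outside x)
    outside? x = ¬? (any? (λ i → O i ≟ x))

    covering⇒order≤ : (∀ x → ¬ Outside x) → order ≤ n
    covering⇒order≤ covers = ℕ.≤-trans
      (unique∧⊆⇒length≤ elements-unique (λ {x} _ → inside (outside? x)))
      (ℕ.≤-reflexive (length-tabulate O))
      where
      inside : ∀ {x} → Dec (Outside x) → x ∈ tabulate O
      inside {x} (yes out) = contradiction out (covers x)
      inside (no ¬out) with i , refl ← decidable-stable (any? (λ i → O i ≟ _)) ¬out = ∈-tabulate⁺ i

    constant-outside⇒valueSetSize≤ : (F : Carrier → Carrier) (c : Carrier) →
                                      (∀ x → Outside x → F x ≡ c) → valueSetSize K F ≤ suc n
    constant-outside⇒valueSetSize≤ F c const = ℕ.≤-trans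
      (unique∧⊆⇒length≤ (valueList-unique F) V⊆c∷F[O])
      (ℕ.≤-reflexive (cong suc (trans (length-map F (tabulate O)) (length-tabulate O))))
      where
      V⊆c∷F[O] : valueList F ⊆ c ∷ map F (tabulate O)
      V⊆c∷F[O] y∈V with x , refl ← ∈-valueList⁻ F y∈V with any? (λ i → O i ≟ x)
      ... | yes (i , refl) = there (∈-map⁺ F (∈-tabulate⁺ i))
      ... | no out = here (const x out)

    injective-outside⇒order∸n≤valueSetSize :
      (F h : Carrier → Carrier) → (∀ {x y} → h x ≡ h y → x ≡ y) →
      (∀ x → Outside x → F x ≡ h x) → order ∸ n ≤ valueSetSize K F
    injective-outside⇒order∸n≤valueSetSize F h h-injective F≡h = ℕ.≤-trans
      (ℕ.m≤n+o⇒m∸n≤o order n q≤n+|C|)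
      (ℕ.≤-trans (ℕ.≤-reflexive (sym (length-map h C)))
                 (unique∧⊆⇒length≤ (UP.map⁺ h-injective (UP.filter⁺ outside? elements-unique)) h[C]⊆V))
      where
      C : List Carrier
      C = filter outside? elements
      h[C]⊆V : map h C ⊆ valueList F
      h[C]⊆V y∈h[C] with x , x∈C , refl ← ∈-map⁻ h y∈h[C] =
        subst (_∈ valueList F) (F≡h x (proj₂ (∈-filter⁻ outside? {xs = elements} x∈C)))
              (∈-valueList⁺ F x)
      elements⊆C++O : elements ⊆ C ++ tabulate O
      elements⊆C++O {x} x∈E with outside? x
      ... | yes out = ∈-++⁺ˡ (∈-filter⁺ outside? x∈E out)
      ... | no ¬out with i , refl ← decidable-stable (any? (λ i → O i ≟ x)) ¬out =
        ∈-++⁺ʳ C (∈-tabulate⁺ i)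
      q≤n+|C| : order ≤ n ℕ.+ length C
      q≤n+|C| = begin
        order                            ≤⟨ unique∧⊆⇒length≤ elements-unique elements⊆C++O ⟩
        length (C ++ tabulate O)         ≡⟨ length-++ C ⟩
        length C ℕ.+ length (tabulate O) ≡⟨ cong (length C ℕ.+_) (length-tabulate O) ⟩
        length C ℕ.+ n                   ≡⟨ ℕ.+-comm (length C) n ⟩
        n ℕ.+ length C                   ∎
        where open ℕ.≤-Reasoning

module Construction (K : FiniteField) (a b : FiniteField.Carrier K) {k : ℕ}
                    (O : Fin (suc k) → FiniteField.Carrier K) where
  open FiniteField K
  open IsCommutativeRing isCommutativeRing
    using (+-identityˡ; +-assoc; +-comm; *-comm; *-identityˡ; distribʳ; zeroˡ; -‿inverseˡ)
  private
    commutativeRing : CommutativeRing 0ℓ 0ℓ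
    commutativeRing = record { isCommutativeRing = isCommutativeRing }
  open CommutativeRing commutativeRing using (+-group; ring)
  open import Algebra.Properties.Group +-group using (//-rightDividesˡ) renaming (∙-cancelʳ to +-cancelʳ)
  open import Algebra.Properties.Ring ring using (-‿distribʳ-*)

  g f F : Carrier → Carrier
  g = gMap K a b
  f = fMap K a b O
  F = FMap K a b O

  fMap-head : Injective _≡_ _≡_ O → f (O zero) ≡ 0#
  fMap-head O-injective with any? (λ i → O i ≟ O zero)
  ... | yes (zero , _) = refl
  ... | yes (suc i , Oi≡O0) = contradiction (O-injective Oi≡O0) λ ()
  ... | no ∄i = contradiction (zero , refl) ∄i

  fMap-suc : Injective _≡_ _≡_ O → ∀ i → f (O (suc i)) ≡ g (O (inject₁ i))
  fMap-suc O-injective i with any? (λ j → O j ≟ O (suc i))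
  ... | yes (zero , O0≡Osi) = contradiction (O-injective O0≡Osi) λ ()
  ... | yes (suc j , Osj≡Osi) with refl ← O-injective Osj≡Osi = refl
  ... | no ∄j = contradiction (suc i , refl) ∄j

  fMap-outside : ∀ x → Outside K O x → f x ≡ g x
  fMap-outside x out with any? (λ i → O i ≟ x)
  ... | yes inside = contradiction inside out
  ... | no _ = refl

  module _ (a≢0 : a ≢ 0#) where

    gMap-preimage : ∀ y → g (inv a a≢0 * (y + - b)) ≡ y
    gMap-preimage y = trans (cong (_+ b) (x*[x⁻¹*y]≡y K a a≢0 (y + - b))) (//-rightDividesˡ b y)

    gMap-root : g (- (b * inv a a≢0)) ≡ 0#
    gMap-root = begin
      a * - (b * inv a a≢0) + b   ≡⟨ cong (_+ b) (-‿distribʳ-* a _) ⟨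
      - (a * (b * inv a a≢0)) + b ≡⟨ cong (λ t → - (a * t) + b) (*-comm b _) ⟩
      - (a * (inv a a≢0 * b)) + b ≡⟨ cong (λ t → - t + b) (x*[x⁻¹*y]≡y K a a≢0 b) ⟩
      - b + b                     ≡⟨ -‿inverseˡ b ⟩
      0#                          ∎
      where open ≡-Reasoning

    module _ (O-injective : Injective _≡_ _≡_ O) (O-last : O (fromℕ k) ≡ - (b * inv a a≢0)) where

      fMap-hits : ∀ {y} z → y ≢ 0# → g z ≡ y → ∃ λ x → f x ≡ y
      fMap-hits {y} z y≢0 gz≡y with any? (λ i → O i ≟ z)
      ... | no out = z , trans (fMap-outside z out) gz≡y
      ... | yes (i , refl) with k ℕ.≟ toℕ i
      ...   | yes k≡i = contradiction y≡0 y≢0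
        where
        i≡last : i ≡ fromℕ k
        i≡last = toℕ-injective (trans (sym k≡i) (sym (toℕ-fromℕ k)))
        y≡0 : y ≡ 0#
        y≡0 = trans (sym gz≡y) (trans (cong (g ∘ O) i≡last) (trans (cong g O-last) gMap-root))
      ...   | no k≢i = O (suc (lower₁ i k≢i)) ,
                       trans (fMap-suc O-injective _) (trans (cong (g ∘ O) (inject₁-lower₁ i k≢i)) gz≡y)

      fMap-surjective : Surjective K f
      fMap-surjective y with y ≟ 0#
      ... | yes refl = O zero , fMap-head O-injective
      ... | no y≢0 = fMap-hits _ y≢0 (gMap-preimage y)

  FMap-head : Injective _≡_ _≡_ O → O zero ≡ 0# → F (O zero) ≡ 0#
  FMap-head O-injective O0≡0 = trans (cong₂ _+_ (fMap-head O-injective) O0≡0) (+-identityˡ 0#)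

  FMap-outside : ∀ x → Outside K O x → F x ≡ (a + 1#) * x + b
  FMap-outside x out = begin
    f x + x              ≡⟨ cong (_+ x) (fMap-outside x out) ⟩
    (a * x + b) + x      ≡⟨ +-assoc _ b x ⟩
    a * x + (b + x)      ≡⟨ cong (a * x +_) (+-comm b x) ⟩
    a * x + (x + b)      ≡⟨ +-assoc _ x b ⟨
    (a * x + x) + b      ≡⟨ cong (λ t → a * x + t + b) (*-identityˡ x) ⟨
    (a * x + 1# * x) + b ≡⟨ cong (_+ b) (distribʳ x a 1#) ⟨
    (a + 1#) * x + b     ∎
    where open ≡-Reasoning

  module _ (a+1≡0 : a + 1# ≡ 0#) where

    FMap-outside≡b : ∀ x → Outside K O x → F x ≡ b
    FMap-outside≡b x out = begin
      F x              ≡⟨ FMap-outside x out ⟩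
      (a + 1#) * x + b ≡⟨ cong (λ t → t * x + b) a+1≡0 ⟩
      0# * x + b       ≡⟨ cong (_+ b) (zeroˡ x) ⟩
      0# + b           ≡⟨ +-identityˡ b ⟩
      b                ∎
      where open ≡-Reasoning

    module _ (O-injective : Injective _≡_ _≡_ O) (O0≡0 : O zero ≡ 0#) (b≢0 : b ≢ 0#) where

      outside⇒2≤valueSetSize : ∀ x → Outside K O x → 2 ≤ valueSetSize K F
      outside⇒2≤valueSetSize x out =
        unique∧⊆⇒length≤ (((λ 0≡b → b≢0 (sym 0≡b)) ∷ []) ∷ [] ∷ []) 0∷b⊆V
        where
        0∷b⊆V : 0# ∷ b ∷ [] ⊆ valueList K F
        0∷b⊆V (here refl) =
          subst (_∈ valueList K F) (FMap-head O-injective O0≡0) (∈-valueList⁺ K F (O zero))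
        0∷b⊆V (there (here refl)) =
          subst (_∈ valueList K F) (FMap-outside≡b x out) (∈-valueList⁺ K F x)

      spectrum-a≡-1 : 3 ≤ order →
        let m = valueSetSize K F in
        (2 ≤ m × m ≤ suc (suc k)) ⊎ (order ∸ suc k ≤ m × m ≤ order ∸ 2)
      spectrum-a≡-1 3≤q with 2 ℕ.≤? valueSetSize K F
      ... | yes 2≤m = inj₁ (2≤m , constant-outside⇒valueSetSize≤ K O F b FMap-outside≡b)
      ... | no 2≰m = inj₂ (q∸n≤m , ℕ.≤-trans (ℕ.≤-pred (ℕ.≰⇒> 2≰m)) (ℕ.∸-monoˡ-≤ 2 3≤q))
        where
        q∸n≤m : order ∸ suc k ≤ valueSetSize K F
        q∸n≤m = ℕ.≤-trans (ℕ.≤-reflexive (ℕ.m≤n⇒m∸n≡0 q≤n)) z≤n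
          where
          q≤n : order ≤ suc k
          q≤n = covering⇒order≤ K O λ x out → 2≰m (outside⇒2≤valueSetSize x out)

  module _ (a+1≢0 : a + 1# ≢ 0#) where

    affine-injective : ∀ {x y} → (a + 1#) * x + b ≡ (a + 1#) * y + b → x ≡ y
    affine-injective eq = *-cancelˡ-nonZero K (a + 1#) a+1≢0 (+-cancelʳ b _ _ eq)

    spectrum-a≢-1 : (a≢0 : a ≢ 0#) → Injective _≡_ _≡_ O → O (fromℕ k) ≡ - (b * inv a a≢0) →
      3 ≤ order →
      let m = valueSetSize K F in
      (order ∸ suc k ≤ m × m ≤ order ∸ 2) ⊎ m ≡ order
    spectrum-a≢-1 a≢0 O-injective O-last 3≤q with valueSetSize K F ℕ.≟ order
    ... | yes m≡q = inj₂ m≡q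
    ... | no m≢q = inj₁ (injective-outside⇒order∸n≤valueSetSize K O F _ affine-injective FMap-outside ,
                         ℕ.∸-monoˡ-≤ 2 (ℕ.≤∧≢⇒< m<q 1+m≢q))
      where
      m<q : valueSetSize K F < order
      m<q = ℕ.≤∧≢⇒< (valueSetSize≤order K F) m≢q
      1+m≢q : suc (valueSetSize K F) ≢ order
      1+m≢q = valueSetSize-+id≢pred K 3≤q (fMap-surjective a≢0 O-injective O-last)

  spectrum : (a≢0 : a ≢ 0#) → b ≢ 0# → Injective _≡_ _≡_ O → O zero ≡ 0# →
    O (fromℕ k) ≡ - (b * inv a a≢0) → 3 ≤ order →
    let m = valueSetSize K F in
    (2 ≤ m × m ≤ suc (suc k)) ⊎ ((order ∸ suc k ≤ m × m ≤ order ∸ 2) ⊎ m ≡ order)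
  spectrum a≢0 b≢0 O-injective O0≡0 O-last 3≤q with (a + 1#) ≟ 0#
  ... | yes a+1≡0 = Sum.map₂ inj₁ (spectrum-a≡-1 a+1≡0 O-injective O0≡0 b≢0 3≤q)
  ... | no a+1≢0 = inj₂ (spectrum-a≢-1 a+1≢0 a≢0 O-injective O-last 3≤q)

theorem1 : (K : FiniteField) → let open FiniteField K in
    ¬ (2 ∣ order) → 5 ≤ order →
    (k : ℕ) → 1 ≤ k →
    (a b : Carrier) (a≢0 : ¬ (a ≡ 0#)) → ¬ (b ≡ 0#) →
    (O : Fin (suc k) → Carrier) → Injective _≡_ _≡_ O →
    O zero ≡ 0# → O (fromℕ k) ≡ - (b * inv a a≢0) →
    let m = valueSetSize K (FMap K a b O) in
    (2 ≤ m × m ≤ suc (suc k))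
    ⊎ ((order ∸ suc k ≤ m × m ≤ order ∸ 2) ⊎ m ≡ order)
theorem1 K _ 5≤q k _ a b a≢0 b≢0 O O-injective O0≡0 O-last =
  Construction.spectrum K a b O a≢0 b≢0 O-injective O0≡0 O-last (ℕ.m+n≤o⇒n≤o 2 5≤q)
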